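{- Let $n>3$ be an integer such that $p=4n-1$ is prime. Let \[A_{\ge}=\{k\in\{2,\dots,n+2\}: r_p((k-1)^2)\ge 3n+k-3\},\qquad B_{<}=\{k\in\{n+3,\dots,2n\}: r_p((k-1)^2)<k-n-2\}.\] Then the map $f:A_{\ge}\to B_{<}$, $f(k)=2n+2-k$, is well defined and bijective.
   Context: For a positive integer $q$ and $x\in\mathbb{Z}$, $r_q(x)\in\{0,1,\dots,q-1\}$ denotes the remainder of $x$ upon division by $q$. -}

module Defs where

open import Data.Nat using (ℕ; suc; _+_; _*_; _∸_; _≤_; _<_; _≥_; _^_)
open import Data.Nat.DivMod using (_%_)
open import Data.Product using (_×_)

-- r_p(x) with p = 4n-1 (for n ≥ 1, p = suc (4 * n ∸ 2)).
r : ℕ → ℕ → ℕ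
r n x = x % suc (4 * n ∸ 2)

InA : ℕ → ℕ → Set
InA n k = (2 ≤ k × k ≤ n + 2) × (r n ((k ∸ 1) ^ 2) ≥ 3 * n + k ∸ 3)

InB : ℕ → ℕ → Set
InB n k = (n + 3 ≤ k × k ≤ 2 * n) × (r n ((k ∸ 1) ^ 2) < k ∸ n ∸ 2)

f : ℕ → ℕ → ℕ
f n k = 2 * n + 2 ∸ k

{-# OPTIONS --safe #-}
-- Put p = 4n − 1, k = j + 1 and J = 2n − j, so that f k = J + 1. As 4n ≡ 1 (mod p),
-- J² = (2n − j)² ≡ j² − j + n (mod p). If j² ≡ a with 3n + j − 2 ≤ a < p, then
-- J² ≡ a + n − j − p, which lies in [0, n − j − 2] unless a = p − 1 or a + n − j = p − 1,
-- i.e. unless −1 is a square modulo p; conversely a residue b ≤ n − j − 2 of J² makes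
-- b + j + 3n − 1 the residue of j². That −1 is not a square modulo any m ≡ 3 (mod 4)
-- follows by Fermat's descent: a root of x² + 1 can be chosen even, 2y < m, and then
-- 4y² + 1 = c m with c < m and c ≡ 3 (mod 4).
module Submission where

open import Defs
open import Level using (0ℓ)
open import Data.Nat
open import Data.Nat.Properties
open import Data.Nat.DivMod hiding (_mod_)
open import Data.Nat.Divisibility
open import Data.Nat.Induction using (<-rec)
open import Data.Nat.Primality using (Prime)
open import Data.Nat.Tactic.RingSolver using (solve)
open import Data.List.Base using (_∷_; [])
open import Data.Product using (∃₂; ∃-syntax; _×_; _,_)
open import Data.Sum using (_⊎_; inj₁; inj₂)
open import Function.Base using (_∘_)
open import Function.Bundles using (_⇔_; mk⇔; Equivalence)
open import Relation.Nullary using (¬_; contradiction)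
open import Relation.Binary.Bundles using (Setoid)
open import Relation.Binary.PropositionalEquality
import Relation.Binary.Reasoning.Setoid as SetoidReasoning

infix 4 _≡_mod_

_≡_mod_ : ℕ → ℕ → ℕ → Set
_≡_mod_ x y p = ∃₂ λ k l → x + k * p ≡ y + l * p

module _ {p : ℕ} where

  ≡[mod]-sym : ∀ {x y} → x ≡ y mod p → y ≡ x mod p
  ≡[mod]-sym (k , l , e) = l , k , sym e

  ≡[mod]-trans : ∀ {x y z} → x ≡ y mod p → y ≡ z mod p → x ≡ z mod p
  ≡[mod]-trans {x} {y} {z} (k , l , e) (k′ , l′ , e′) = k + k′ , l′ + l , (begin
    x + (k + k′) * p   ≡⟨ solve (x ∷ k ∷ k′ ∷ p ∷ []) ⟩
    x + k * p + k′ * p ≡⟨ cong (_+ k′ * p) e ⟩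
    y + l * p + k′ * p ≡⟨ solve (y ∷ l ∷ k′ ∷ p ∷ []) ⟩
    y + k′ * p + l * p ≡⟨ cong (_+ l * p) e′ ⟩
    z + l′ * p + l * p ≡⟨ solve (z ∷ l′ ∷ l ∷ p ∷ []) ⟩
    z + (l′ + l) * p   ∎)
    where open ≡-Reasoning

  ≡[mod]-setoid : Setoid 0ℓ 0ℓ
  ≡[mod]-setoid = record
    { Carrier       = ℕ
    ; _≈_           = λ x y → x ≡ y mod p
    ; isEquivalence = record { refl = 0 , 0 , refl ; sym = ≡[mod]-sym ; trans = ≡[mod]-trans }
    }

  +-congʳ-≡[mod] : ∀ {x y} z → x ≡ y mod p → x + z ≡ y + z mod p
  +-congʳ-≡[mod] {x} {y} z (k , l , e) = k , l , (begin
    x + z + k * p ≡⟨ solve (x ∷ z ∷ k ∷ p ∷ []) ⟩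
    x + k * p + z ≡⟨ cong (_+ z) e ⟩
    y + l * p + z ≡⟨ solve (y ∷ l ∷ z ∷ p ∷ []) ⟩
    y + z + l * p ∎)
    where open ≡-Reasoning

  +-congˡ-≡[mod] : ∀ {x y} z → x ≡ y mod p → z + x ≡ z + y mod p
  +-congˡ-≡[mod] {x} {y} z (k , l , e) = k , l , (begin
    z + x + k * p   ≡⟨ +-assoc z x (k * p) ⟩
    z + (x + k * p) ≡⟨ cong (z +_) e ⟩
    z + (y + l * p) ≡⟨ +-assoc z y (l * p) ⟨
    z + y + l * p   ∎)
    where open ≡-Reasoning

  *-cong-≡[mod] : ∀ {x y u v} → x ≡ y mod p → u ≡ v mod p → x * u ≡ y * v mod p
  *-cong-≡[mod] {x} {y} {u} {v} (k , l , e) (k′ , l′ , e′) =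
    k * u + x * k′ + k * k′ * p , l * v + y * l′ + l * l′ * p , (begin
      x * u + (k * u + x * k′ + k * k′ * p) * p ≡⟨ solve (x ∷ u ∷ k ∷ k′ ∷ p ∷ []) ⟩
      (x + k * p) * (u + k′ * p)                ≡⟨ cong₂ _*_ e e′ ⟩
      (y + l * p) * (v + l′ * p)                ≡⟨ solve (y ∷ v ∷ l ∷ l′ ∷ p ∷ []) ⟩
      y * v + (l * v + y * l′ + l * l′ * p) * p ∎)
    where open ≡-Reasoning

  +-cancelʳ-≡[mod] : ∀ {x y} z → x + z ≡ y + z mod p → x ≡ y mod p
  +-cancelʳ-≡[mod] {x} {y} z (k , l , e) = k , l , +-cancelʳ-≡ z _ _ (begin
    x + k * p + z ≡⟨ solve (x ∷ z ∷ k ∷ p ∷ []) ⟩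
    x + z + k * p ≡⟨ e ⟩
    y + z + l * p ≡⟨ solve (y ∷ l ∷ z ∷ p ∷ []) ⟩
    y + l * p + z ∎)
    where open ≡-Reasoning

  m+n≡m[mod] : ∀ x → x + p ≡ x mod p
  m+n≡m[mod] x = 0 , 1 , solve (x ∷ p ∷ [])

  ∣⇒≡0[mod] : ∀ {x} → p ∣ x → x ≡ 0 mod p
  ∣⇒≡0[mod] (divides q refl) = 0 , q , +-identityʳ _

  ≡0[mod]⇒∣ : ∀ {x} → x ≡ 0 mod p → p ∣ x
  ≡0[mod]⇒∣ {x} (k , l , e) =
    ∣m+n∣m⇒∣n (subst (p ∣_) (trans (sym e) (+-comm x (k * p))) (n∣m*n l)) (n∣m*n k)

  module _ .{{_ : NonZero p}} where

    m≡m%n[mod] : ∀ x → x ≡ x % p mod p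
    m≡m%n[mod] x = 0 , x / p , trans (+-identityʳ x) (m≡m%n+[m/n]*n x p)

    ≡[mod]⇒%≡ : ∀ {x y} → x ≡ y mod p → y < p → x % p ≡ y
    ≡[mod]⇒%≡ {x} {y} (k , l , e) y<p = begin
      x % p           ≡⟨ [m+kn]%n≡m%n x k p ⟨
      (x + k * p) % p ≡⟨ %-congˡ e ⟩
      (y + l * p) % p ≡⟨ [m+kn]%n≡m%n y l p ⟩
      y % p           ≡⟨ m<n⇒m%n≡m y<p ⟩
      y               ∎
      where open ≡-Reasoning

-- −1 is not a square modulo any m ≡ 3 (mod 4)

even-or-odd : ∀ u → ∃[ h ] (u ≡ 2 * h ⊎ u ≡ suc (2 * h))
even-or-odd zero = 0 , inj₁ refl
even-or-odd (suc u) with even-or-odd u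
... | h , inj₁ refl = h , inj₂ refl
... | h , inj₂ refl = suc h , inj₁ (solve (h ∷ []))

odd-sum⇒even-summand : ∀ u z → (u + z) % 2 ≡ 1 → ∃[ y ] (u ≡ 2 * y ⊎ z ≡ 2 * y)
odd-sum⇒even-summand u z odd with even-or-odd u | even-or-odd z
... | h , inj₁ u≡2h | _             = h , inj₁ u≡2h
... | _ , inj₂ _    | w , inj₁ z≡2w = w , inj₂ z≡2w
... | h , inj₂ refl | w , inj₂ refl = contradiction (trans (sym even) odd) 0≢1+n
  where
  even : (suc (2 * h) + suc (2 * w)) % 2 ≡ 0
  even = begin
    (suc (2 * h) + suc (2 * w)) % 2 ≡⟨ cong (_% 2) sum≡ ⟩
    (suc (h + w) * 2) % 2           ≡⟨ m*n%n≡0 (suc (h + w)) 2 ⟩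
    0                               ∎
    where
    open ≡-Reasoning
    sum≡ : suc (2 * h) + suc (2 * w) ≡ suc (h + w) * 2
    sum≡ = solve (h ∷ w ∷ [])

∣1+x²⇒∣1+[x%m]² : ∀ m x .{{_ : NonZero m}} → m ∣ suc (x * x) → m ∣ suc (x % m * (x % m))
∣1+x²⇒∣1+[x%m]² m x m∣1+x² = ≡0[mod]⇒∣ (≡[mod]-trans (≡[mod]-sym 1+x²≡1+r²) (∣⇒≡0[mod] m∣1+x²))
  where
  x≡r = m≡m%n[mod] x
  1+x²≡1+r² : suc (x * x) ≡ suc (x % m * (x % m)) mod m
  1+x²≡1+r² = +-congˡ-≡[mod] 1 (*-cong-≡[mod] x≡r x≡r)

∣1+u²⇒∣1+z² : ∀ u z → u + z ∣ suc (u * u) → u + z ∣ suc (z * z)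
∣1+u²⇒∣1+z² u z m∣1+u² = ≡0[mod]⇒∣ (≡[mod]-trans 1+z²≡1+u² (∣⇒≡0[mod] m∣1+u²))
  where
  1+z²≡1+u² : suc (z * z) ≡ suc (u * u) mod (u + z)
  1+z²≡1+u² = 2 * u , u + z , solve (u ∷ z ∷ [])

%4≡3⇒%2≡1 : ∀ m → m % 4 ≡ 3 → m % 2 ≡ 1
%4≡3⇒%2≡1 m m%4≡3 = trans (sym (m∣n⇒o%n%m≡o%m 2 4 m (divides 2 refl))) (cong (_% 2) m%4≡3)

*%4≡1⇒%4≡3 : ∀ c m → m % 4 ≡ 3 → (c * m) % 4 ≡ 1 → c % 4 ≡ 3
*%4≡1⇒%4≡3 c m m%4≡3 cm%4≡1 = residue (c % 4) (m%n<n c 4) (begin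
  (c % 4 * 3) % 4       ≡⟨ cong (λ t → (c % 4 * t) % 4) m%4≡3 ⟨
  (c % 4 * (m % 4)) % 4 ≡⟨ %-distribˡ-* c m 4 ⟨
  (c * m) % 4           ≡⟨ cm%4≡1 ⟩
  1                     ∎)
  where
  open ≡-Reasoning
  residue : ∀ s → s < 4 → (s * 3) % 4 ≡ 1 → s ≡ 3
  residue 3 _ _ = refl
  residue (suc (suc (suc (suc _)))) (s≤s (s≤s (s≤s (s≤s ())))) _

1+x²<m² : ∀ {x m} → x < m → 1 < m → suc (x * x) < m * m
1+x²<m² {x} {m} x<m 1<m = begin-strict
  suc (x * x) ≤⟨ s≤s (*-monoʳ-≤ x (<⇒≤ x<m)) ⟩
  suc (x * m) ≡⟨ +-comm 1 (x * m) ⟩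
  x * m + 1   <⟨ +-monoʳ-< (x * m) 1<m ⟩
  x * m + m   ≡⟨ +-comm (x * m) m ⟩
  suc x * m   ≤⟨ *-monoˡ-≤ m x<m ⟩
  m * m       ∎
  where open ≤-Reasoning

%2≡1⇒≢2* : ∀ {m} y → m % 2 ≡ 1 → m ≢ 2 * y
%2≡1⇒≢2* y m%2≡1 refl = 0≢1+n (trans (sym (trans (cong (_% 2) (*-comm 2 y)) (m*n%n≡0 y 2))) m%2≡1)

even-root : ∀ m x .{{_ : NonZero m}} → m % 4 ≡ 3 → m ∣ suc (x * x) →
            ∃[ y ] (2 * y < m × m ∣ suc (2 * y * (2 * y)))
even-root m x m%4≡3 m∣1+x² = choose (odd-sum⇒even-summand u z (subst (λ t → t % 2 ≡ 1) (sym u+z≡m) m%2≡1))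
  where
  u = x % m
  z = m ∸ u
  u+z≡m : u + z ≡ m
  u+z≡m = m+[n∸m]≡n (<⇒≤ (m%n<n x m))
  m%2≡1 : m % 2 ≡ 1
  m%2≡1 = %4≡3⇒%2≡1 m m%4≡3
  m∣1+u² : m ∣ suc (u * u)
  m∣1+u² = ∣1+x²⇒∣1+[x%m]² m x m∣1+x²
  m∣1+z² : m ∣ suc (z * z)
  m∣1+z² = subst (λ t → t ∣ suc (z * z)) u+z≡m
             (∣1+u²⇒∣1+z² u z (subst (λ t → t ∣ suc (u * u)) (sym u+z≡m) m∣1+u²))
  choose : ∃[ y ] (u ≡ 2 * y ⊎ z ≡ 2 * y) → ∃[ y ] (2 * y < m × m ∣ suc (2 * y * (2 * y)))
  choose (y , inj₁ u≡2y) =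
    y , subst (_< m) u≡2y (m%n<n x m) , subst (λ t → m ∣ suc (t * t)) u≡2y m∣1+u²
  choose (y , inj₂ z≡2y) =
    y , ≤∧≢⇒< (subst (_≤ m) z≡2y (m∸n≤m m u)) (%2≡1⇒≢2* y m%2≡1 ∘ sym) ,
    subst (λ t → m ∣ suc (t * t)) z≡2y m∣1+z²

m%4≡3⇒∤1+x² : ∀ m → m % 4 ≡ 3 → ∀ x → ¬ m ∣ suc (x * x)
m%4≡3⇒∤1+x² = <-rec (λ m → m % 4 ≡ 3 → ∀ x → ¬ m ∣ suc (x * x)) descent
  where
  descent : ∀ m → (∀ {c} → c < m → c % 4 ≡ 3 → ∀ x → ¬ c ∣ suc (x * x)) →
            m % 4 ≡ 3 → ∀ x → ¬ m ∣ suc (x * x)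
  descent zero _ ()
  descent m@(suc _) ih m%4≡3 x m∣1+x² with even-root m x m%4≡3 m∣1+x²
  ... | y , 2y<m , divides c 1+4y²≡cm = ih c<m c%4≡3 (2 * y) (divides m (trans 1+4y²≡cm (*-comm c m)))
    where
    1<m : 1 < m
    1<m = ≤-trans (s≤s (s≤s z≤n)) (subst (_≤ m) m%4≡3 (m%n≤m m 4))
    c<m : c < m
    c<m = *-cancelʳ-< m c m (subst (_< m * m) 1+4y²≡cm (1+x²<m² 2y<m 1<m))
    1+4y²≡1+y²*4 : suc (2 * y * (2 * y)) ≡ 1 + y * y * 4
    1+4y²≡1+y²*4 = solve (y ∷ [])
    c%4≡3 : c % 4 ≡ 3
    c%4≡3 = *%4≡1⇒%4≡3 c m m%4≡3 (begin
      (c * m) % 4               ≡⟨ cong (_% 4) (trans (sym 1+4y²≡cm) 1+4y²≡1+y²*4) ⟩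
      (1 + y * y * 4) % 4       ≡⟨ [m+kn]%n≡m%n 1 (y * y) 4 ⟩
      1                         ∎)
      where open ≡-Reasoning

-- Squares modulo p = 4n − 1

1+p≡4n⇒p%4≡3 : ∀ {p n} → suc p ≡ 4 * n → p % 4 ≡ 3
1+p≡4n⇒p%4≡3 {p} {suc n} 1+p≡4n = trans (cong (_% 4) p≡3+n*4) ([m+kn]%n≡m%n 3 n 4)
  where
  p≡3+n*4 : p ≡ 3 + n * 4
  p≡3+n*4 = suc-injective (trans 1+p≡4n (solve (n ∷ [])))

1+p≡4n⇒n<p : ∀ {p n} → suc p ≡ 4 * n → n < p
1+p≡4n⇒n<p {p} {suc n} 1+p≡4n = subst (suc n <_) (sym p≡) (s≤s (m≤m+n (suc n) (1 + 3 * n)))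
  where
  p≡ : p ≡ suc (suc n + (1 + 3 * n))
  p≡ = suc-injective (trans 1+p≡4n (solve (n ∷ [])))

module _ {p n : ℕ} .{{_ : NonZero p}} (1+p≡4n : suc p ≡ 4 * n) where

  square-swap : ∀ J j → J + j ≡ 2 * n → J * J + j ≡ j * j + n mod p
  square-swap J j J+j≡2n = j , n , (begin
    J * J + j + j * p         ≡⟨ solve (J ∷ j ∷ p ∷ []) ⟩
    J * J + j * suc p         ≡⟨ cong (λ t → J * J + j * t) 1+p≡4n ⟩
    J * J + j * (4 * n)       ≡⟨ solve (J ∷ j ∷ n ∷ []) ⟩
    J * J + 2 * j * (2 * n)   ≡⟨ cong (λ t → J * J + 2 * j * t) J+j≡2n ⟨
    J * J + 2 * j * (J + j)   ≡⟨ solve (J ∷ j ∷ []) ⟩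
    j * j + (J + j) * (J + j) ≡⟨ cong (λ t → j * j + t * t) J+j≡2n ⟩
    j * j + 2 * n * (2 * n)   ≡⟨ solve (j ∷ n ∷ []) ⟩
    j * j + n * (4 * n)       ≡⟨ cong (λ t → j * j + n * t) 1+p≡4n ⟨
    j * j + n * suc p         ≡⟨ solve (j ∷ n ∷ p ∷ []) ⟩
    j * j + n + n * p         ∎)
    where open ≡-Reasoning

  square-swap⇒ : ∀ {J j a c} e → J + j ≡ 2 * n → j * j ≡ a mod p → a + n + e ≡ c + j + p →
                 J * J + e ≡ c mod p
  square-swap⇒ {J} {j} {a} {c} e J+j≡2n j²≡a a+n+e≡c+j+p = +-cancelʳ-≡[mod] j (begin
    J * J + e + j ≡⟨ solve (J ∷ e ∷ j ∷ []) ⟩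
    J * J + j + e ≈⟨ +-congʳ-≡[mod] e (square-swap J j J+j≡2n) ⟩
    j * j + n + e ≈⟨ +-congʳ-≡[mod] e (+-congʳ-≡[mod] n j²≡a) ⟩
    a + n + e     ≡⟨ a+n+e≡c+j+p ⟩
    c + j + p     ≈⟨ m+n≡m[mod] (c + j) ⟩
    c + j         ∎)
    where open SetoidReasoning ≡[mod]-setoid

  square-swap⇐ : ∀ {J j a b} → J + j ≡ 2 * n → J * J ≡ b mod p → b + j + p ≡ a + n → j * j ≡ a mod p
  square-swap⇐ {J} {j} {a} {b} J+j≡2n J²≡b b+j+p≡a+n = +-cancelʳ-≡[mod] n (begin
    j * j + n     ≈⟨ square-swap J j J+j≡2n ⟨
    J * J + j     ≈⟨ +-congʳ-≡[mod] j J²≡b ⟩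
    b + j         ≈⟨ m+n≡m[mod] (b + j) ⟨
    b + j + p     ≡⟨ b+j+p≡a+n ⟩
    a + n         ∎)
    where open SetoidReasoning ≡[mod]-setoid

  private
    ∤1+x² : ∀ x → ¬ p ∣ suc (x * x)
    ∤1+x² = m%4≡3⇒∤1+x² p (1+p≡4n⇒p%4≡3 {n = n} 1+p≡4n)

  2+x²%p≤p : ∀ x → 2 + x * x % p ≤ p
  2+x²%p≤p x = ≤∧≢⇒< (m%n<n (x * x) p) λ 1+r≡p → ∤1+x² x (≡0[mod]⇒∣ (begin
    suc (x * x)     ≈⟨ +-congˡ-≡[mod] 1 (m≡m%n[mod] (x * x)) ⟩
    suc (x * x % p) ≡⟨ 1+r≡p ⟩
    p               ≈⟨ m+n≡m[mod] 0 ⟩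
    0               ∎))
    where open SetoidReasoning ≡[mod]-setoid

  A⇒B : ∀ {J j} → J + j ≡ 2 * n → 3 * n + j ≤ 2 + j * j % p → J * J % p + (n + 2) ≤ J
  A⇒B {J} {j} J+j≡2n 3n+j≤2+a =
    residues (m≡m%n[mod] (j * j)) (m≤n⇒∃[o]m+o≡n 3n+j≤2+a) (m≤n⇒∃[o]m+o≡n (2+x²%p≤p j))
    where
    residues : ∀ {a} → j * j ≡ a mod p → ∃[ s ] (3 * n + j + s ≡ 2 + a) → ∃[ t ] (2 + a + t ≡ p) →
               J * J % p + (n + 2) ≤ J
    residues {a} j²≡a (s , 3n+j+s≡2+a) (t , 2+a+t≡p) = conclude s (square-swap⇒ 1 J+j≡2n j²≡a a+n+1≡s+j+p) s+[j+t+1]≡n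
      where
      a+n+1≡s+j+p : a + n + 1 ≡ s + j + p
      a+n+1≡s+j+p = suc-injective (begin
        suc (a + n + 1)   ≡⟨ solve (a ∷ n ∷ []) ⟩
        2 + a + n         ≡⟨ cong (_+ n) 3n+j+s≡2+a ⟨
        3 * n + j + s + n ≡⟨ solve (n ∷ j ∷ s ∷ []) ⟩
        s + j + 4 * n     ≡⟨ cong (s + j +_) 1+p≡4n ⟨
        s + j + suc p     ≡⟨ solve (s ∷ j ∷ p ∷ []) ⟩
        suc (s + j + p)   ∎)
        where open ≡-Reasoning
      s+[j+t+1]≡n : s + (j + t + 1) ≡ n
      s+[j+t+1]≡n = +-cancelˡ-≡ (3 * n) _ _ (begin
        3 * n + (s + (j + t + 1)) ≡⟨ solve (n ∷ j ∷ s ∷ t ∷ []) ⟩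
        3 * n + j + s + t + 1     ≡⟨ cong (λ x → x + t + 1) 3n+j+s≡2+a ⟩
        2 + a + t + 1             ≡⟨ cong (_+ 1) 2+a+t≡p ⟩
        p + 1                     ≡⟨ +-comm p 1 ⟩
        suc p                     ≡⟨ 1+p≡4n ⟩
        4 * n                     ≡⟨ solve (n ∷ []) ⟩
        3 * n + n                 ∎)
        where open ≡-Reasoning
      conclude : ∀ s → J * J + 1 ≡ s mod p → s + (j + t + 1) ≡ n → J * J % p + (n + 2) ≤ J
      conclude zero J²+1≡0 _ = contradiction (≡0[mod]⇒∣ (subst (_≡ 0 mod p) (+-comm (J * J) 1) J²+1≡0)) (∤1+x² J)
      conclude (suc b) J²+1≡1+b 1+b+[j+t+1]≡n =
        subst₂ _≤_ (cong (_+ (n + 2)) (sym J²%p≡b)) b+[n+2]+t≡J (m≤m+n (b + (n + 2)) t)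
        where
        b<p : b < p
        b<p = <-≤-trans (subst (b <_) 1+b+[j+t+1]≡n (m≤m+n (suc b) (j + t + 1))) (<⇒≤ (1+p≡4n⇒n<p 1+p≡4n))
        J²%p≡b : J * J % p ≡ b
        J²%p≡b = ≡[mod]⇒%≡ (+-cancelʳ-≡[mod] 1 (subst (J * J + 1 ≡_mod p) (+-comm 1 b) J²+1≡1+b)) b<p
        b+[n+2]+t≡J : b + (n + 2) + t ≡ J
        b+[n+2]+t≡J = +-cancelʳ-≡ j _ _ (begin
          b + (n + 2) + t + j       ≡⟨ solve (b ∷ n ∷ t ∷ j ∷ []) ⟩
          n + (suc b + (j + t + 1)) ≡⟨ cong (n +_) 1+b+[j+t+1]≡n ⟩
          n + n                     ≡⟨ solve (n ∷ []) ⟩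
          2 * n                     ≡⟨ J+j≡2n ⟨
          J + j                     ∎)
          where open ≡-Reasoning

  B⇒A : ∀ {J j} → J + j ≡ 2 * n → J * J % p + (n + 2) ≤ J → 3 * n + j ≤ 2 + j * j % p
  B⇒A {J} {j} J+j≡2n b+[n+2]≤J = residues (m≡m%n[mod] (J * J)) (m≤n⇒∃[o]m+o≡n b+[n+2]≤J)
    where
    residues : ∀ {b} → J * J ≡ b mod p → ∃[ d ] (b + (n + 2) + d ≡ J) → 3 * n + j ≤ 2 + j * j % p
    residues {b} J²≡b (d , b+[n+2]+d≡J) = complement (m≤n⇒∃[o]m+o≡n 2+d≤p)
      where
      b+j+[2+d]≡n : b + j + (2 + d) ≡ n
      b+j+[2+d]≡n = +-cancelʳ-≡ n _ _ (begin
        b + j + (2 + d) + n ≡⟨ solve (b ∷ j ∷ d ∷ n ∷ []) ⟩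
        b + (n + 2) + d + j ≡⟨ cong (_+ j) b+[n+2]+d≡J ⟩
        J + j               ≡⟨ J+j≡2n ⟩
        2 * n               ≡⟨ solve (n ∷ []) ⟩
        n + n               ∎)
        where open ≡-Reasoning
      2+d≤p : 2 + d ≤ p
      2+d≤p = ≤-trans (subst (2 + d ≤_) b+j+[2+d]≡n (m≤n+m (2 + d) (b + j))) (<⇒≤ (1+p≡4n⇒n<p 1+p≡4n))
      complement : ∃[ a ] (2 + d + a ≡ p) → 3 * n + j ≤ 2 + j * j % p
      complement (a , 2+d+a≡p) =
        subst (λ x → 3 * n + j ≤ 2 + x) (sym j²%p≡a) (subst (3 * n + j ≤_) 3n+j+[1+b]≡2+a (m≤m+n (3 * n + j) (suc b)))
        where
        b+j+p≡a+n : b + j + p ≡ a + n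
        b+j+p≡a+n = begin
          b + j + p               ≡⟨ cong (b + j +_) 2+d+a≡p ⟨
          b + j + (2 + d + a)     ≡⟨ solve (b ∷ j ∷ d ∷ a ∷ []) ⟩
          a + (b + j + (2 + d))   ≡⟨ cong (a +_) b+j+[2+d]≡n ⟩
          a + n                   ∎
          where open ≡-Reasoning
        j²%p≡a : j * j % p ≡ a
        j²%p≡a = ≡[mod]⇒%≡ (square-swap⇐ J+j≡2n J²≡b b+j+p≡a+n) (subst (a <_) 2+d+a≡p (s≤s (m≤n+m a (suc d))))
        3n+j+[1+b]≡2+a : 3 * n + j + suc b ≡ 2 + a
        3n+j+[1+b]≡2+a = +-cancelʳ-≡ (2 + d) _ _ (begin
          3 * n + j + suc b + (2 + d)   ≡⟨ solve (n ∷ j ∷ b ∷ d ∷ []) ⟩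
          3 * n + (b + j + (2 + d)) + 1 ≡⟨ cong (λ x → 3 * n + x + 1) b+j+[2+d]≡n ⟩
          3 * n + n + 1                 ≡⟨ solve (n ∷ []) ⟩
          4 * n + 1                     ≡⟨ cong (_+ 1) 1+p≡4n ⟨
          suc p + 1                     ≡⟨ cong (λ x → suc x + 1) 2+d+a≡p ⟨
          suc (2 + d + a) + 1           ≡⟨ solve (d ∷ a ∷ []) ⟩
          2 + a + (2 + d)               ∎)
          where open ≡-Reasoning

m∸n≤o⇔m≤n+o : ∀ m n o → m ∸ n ≤ o ⇔ m ≤ n + o
m∸n≤o⇔m≤n+o m n o = mk⇔ (λ m∸n≤o → ≤-trans (m≤n+m∸n m n) (+-monoʳ-≤ n m∸n≤o)) (m≤n+o⇒m∸n≤o m n)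

m<n∸o⇔m+o<n : ∀ m {n o} → o ≤ n → m < n ∸ o ⇔ m + o < n
m<n∸o⇔m+o<n m o≤n = mk⇔ (m≤o∸n⇒m+n≤o (suc m) o≤n) (m+n≤o⇒m≤o∸n (suc m))

x^2≡x*x : ∀ x → x ^ 2 ≡ x * x
x^2≡x*x x = cong (x *_) (*-identityʳ x)

InA-residue⇔ : ∀ n j a → 3 * n + suc j ∸ 3 ≤ a ⇔ 3 * n + j ≤ 2 + a
InA-residue⇔ n j a = mk⇔
  (λ h → ≤-pred (subst (_≤ 3 + a) (+-suc (3 * n) j) (Equivalence.to (m∸n≤o⇔m≤n+o _ 3 a) h)))
  (λ h → Equivalence.from (m∸n≤o⇔m≤n+o _ 3 a) (subst (_≤ 3 + a) (sym (+-suc (3 * n) j)) (s≤s h)))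

InB-residue⇔ : ∀ n J b → n + 3 ≤ suc J → b < suc J ∸ n ∸ 2 ⇔ b + (n + 2) ≤ J
InB-residue⇔ n J b n+3≤1+J = mk⇔
  (λ h → s≤s⁻¹ (Equivalence.to (m<n∸o⇔m+o<n b n+2≤1+J) (subst (b <_) (∸-+-assoc (suc J) n 2) h)))
  (λ h → subst (b <_) (sym (∸-+-assoc (suc J) n 2)) (Equivalence.from (m<n∸o⇔m+o<n b n+2≤1+J) (s≤s h)))
  where
  n+2≤1+J : n + 2 ≤ suc J
  n+2≤1+J = ≤-trans (+-monoʳ-≤ n (n≤1+n 2)) n+3≤1+J

f-suc : ∀ n {J j} → J + j ≡ 2 * n → f n (suc j) ≡ suc J
f-suc n {J} {j} J+j≡2n = begin
  2 * n + 2 ∸ suc j     ≡⟨ cong (λ x → x + 2 ∸ suc j) J+j≡2n ⟨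
  J + j + 2 ∸ suc j     ≡⟨ cong (_∸ suc j) J+j+2≡1+J+1+j ⟩
  suc J + suc j ∸ suc j ≡⟨ m+n∸n≡m (suc J) (suc j) ⟩
  suc J                 ∎
  where
  open ≡-Reasoning
  J+j+2≡1+J+1+j : J + j + 2 ≡ suc J + suc j
  J+j+2≡1+J+1+j = solve (J ∷ j ∷ [])

InA⇔InB : ∀ {n J j} → 1 ≤ n → J + j ≡ 2 * n → InA n (suc j) ⇔ InB n (suc J)
InA⇔InB {n} {J} {j} 1≤n J+j≡2n = mk⇔ A→B B→A
  where
  p = suc (4 * n ∸ 2)
  1+p≡4n : suc p ≡ 4 * n
  1+p≡4n = m+[n∸m]≡n (≤-trans (s≤s (s≤s z≤n)) (*-monoʳ-≤ 4 1≤n))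
  1+J≤2n⇔1≤j : suc J ≤ 2 * n ⇔ 1 ≤ j
  1+J≤2n⇔1≤j = mk⇔ (λ h → +-cancelˡ-≤ J 1 j (subst₂ _≤_ (+-comm 1 J) (sym J+j≡2n) h))
                    (λ h → subst₂ _≤_ (+-comm J 1) J+j≡2n (+-monoʳ-≤ J h))
  A→B : InA n (suc j) → InB n (suc J)
  A→B ((s≤s 1≤j , _) , A) = (n+3≤1+J , Equivalence.from 1+J≤2n⇔1≤j 1≤j) ,
    Equivalence.from (InB-residue⇔ n J _ n+3≤1+J) (subst (λ x → x % p + (n + 2) ≤ J) (sym (x^2≡x*x J)) B)
    where
    B : J * J % p + (n + 2) ≤ J
    B = A⇒B 1+p≡4n J+j≡2n (Equivalence.to (InA-residue⇔ n j _) (subst (λ x → 3 * n + suc j ∸ 3 ≤ x % p) (x^2≡x*x j) A))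
    n+3≤1+J : n + 3 ≤ suc J
    n+3≤1+J = subst (_≤ suc J) (sym (+-suc n 2)) (s≤s (≤-trans (m≤n+m (n + 2) (J * J % p)) B))
  B→A : InB n (suc J) → InA n (suc j)
  B→A ((n+3≤1+J , 1+J≤2n) , B) = (s≤s (Equivalence.to 1+J≤2n⇔1≤j 1+J≤2n) , 1+j≤n+2) ,
    subst (λ x → 3 * n + suc j ∸ 3 ≤ x % p) (sym (x^2≡x*x j)) (Equivalence.from (InA-residue⇔ n j _) (B⇒A 1+p≡4n J+j≡2n B′))
    where
    B′ : J * J % p + (n + 2) ≤ J
    B′ = Equivalence.to (InB-residue⇔ n J _ n+3≤1+J) (subst (λ x → x % p < suc J ∸ n ∸ 2) (x^2≡x*x J) B)
    2+j≤n : 2 + j ≤ n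
    2+j≤n = +-cancelˡ-≤ n _ _ (subst₂ _≤_ (+-assoc n 2 j) (trans J+j≡2n (cong (n +_) (+-identityʳ n)))
              (+-monoˡ-≤ j (≤-trans (m≤n+m (n + 2) (J * J % p)) B′)))
    1+j≤n+2 : suc j ≤ n + 2
    1+j≤n+2 = ≤-trans (n≤1+n (suc j)) (≤-trans 2+j≤n (m≤m+n n 2))

theorem4p1 : (n : ℕ) → 3 < n → Prime (4 * n ∸ 1) →
    ((k : ℕ) → InA n k → InB n (f n k))
    × ((k₁ k₂ : ℕ) → InA n k₁ → InA n k₂ → f n k₁ ≡ f n k₂ → k₁ ≡ k₂)
    × ((m : ℕ) → InB n m → ∃[ k ] (InA n k × f n k ≡ m))
theorem4p1 n 3<n _ = A→B , f-injective , B→A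
  where
  1≤n : 1 ≤ n
  1≤n = ≤-trans (s≤s z≤n) 3<n
  A→B : (k : ℕ) → InA n k → InB n (f n k)
  A→B (suc j) k∈A@((_ , 1+j≤n+2) , _) =
    subst (InB n) (sym (f-suc n J+j≡2n)) (Equivalence.to (InA⇔InB 1≤n J+j≡2n) k∈A)
    where
    j≤2n : j ≤ 2 * n
    j≤2n = ≤-trans (s≤s⁻¹ (subst (suc j ≤_) (+-suc n 1) 1+j≤n+2)) (+-monoʳ-≤ n (≤-trans 1≤n (m≤m+n n 0)))
    J+j≡2n : 2 * n ∸ j + j ≡ 2 * n
    J+j≡2n = m∸n+n≡m j≤2n
  f-injective : (k₁ k₂ : ℕ) → InA n k₁ → InA n k₂ → f n k₁ ≡ f n k₂ → k₁ ≡ k₂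
  f-injective _ _ ((_ , k₁≤n+2) , _) ((_ , k₂≤n+2) , _) =
    ∸-cancelˡ-≡ (≤-trans k₁≤n+2 n+2≤2n+2) (≤-trans k₂≤n+2 n+2≤2n+2)
    where
    n+2≤2n+2 : n + 2 ≤ 2 * n + 2
    n+2≤2n+2 = +-monoˡ-≤ 2 (m≤m+n n (n + 0))
  B→A : (m : ℕ) → InB n m → ∃[ k ] (InA n k × f n k ≡ m)
  B→A zero ((n+3≤0 , _) , _) with () ← ≤-trans (m≤n+m 3 n) n+3≤0
  B→A (suc J) m∈B@((_ , 1+J≤2n) , _) =
    suc (2 * n ∸ J) , Equivalence.from (InA⇔InB 1≤n J+j≡2n) m∈B , f-suc n J+j≡2n
    where
    J+j≡2n : J + (2 * n ∸ J) ≡ 2 * n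
    J+j≡2n = m+[n∸m]≡n (<⇒≤ 1+J≤2n)
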